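{- Define $f^{\mathrm W}_1(\omega)=1$ and $f^{\mathrm W}_{p+1}(\omega)={\omega\choose 2}f^{\mathrm W}_p(\omega)+\omega$ for integers $p\ge1$, $\omega\ge1$, and let $f_{pK_2}(\omega)={\omega-1+2(p-1)\choose 2(p-1)}$. For positive integers $\omega,p$: if $\omega>2$ and $p>2$ then $f^{\mathrm W}_p(\omega)>f_{pK_2}(\omega)$, and otherwise $f^{\mathrm W}_p(\omega)=f_{pK_2}(\omega)$. -}

module Defs where

open import Data.Nat using (ℕ; zero; suc; _+_; _*_; _∸_)
open import Data.Nat.Combinatorics using (_C_)

-- f^W_p(ω) for p ≥ 1: f^W_1(ω) = 1, f^W_{p+1}(ω) = C(ω,2)·f^W_p(ω) + ω.
-- The value at p = 0 is a junk value (0) and is never used by the theorem.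
fW : ℕ → ℕ → ℕ
fW zero          ω = 0
fW (suc zero)    ω = 1
fW (suc (suc p)) ω = (ω C 2) * fW (suc p) ω + ω

fpK2 : ℕ → ℕ → ℕ
fpK2 p ω = (ω ∸ 1 + 2 * (p ∸ 1)) C (2 * (p ∸ 1))

module Submission where

-- Both sides satisfy f(1) = 1, and f^W is multiplied by C(ω,2) (plus ω) at each step, while
-- f_{pK₂}, the binomial coefficient C(n, k) with n = ω-1+k and k = 2(p-1), is multiplied by
-- (n+1)(n+2)/((k+1)(k+2)).  For ω ≥ 3 and k ≥ 2 this ratio is at most C(ω,2), so f^W wins by
-- at least ω at every step from p = 2 on, where the two still agree.  For ω ≤ 2 and p ≤ 2 both
-- sides are computed in closed form.

open import Defs
open import Data.Nat using (ℕ; zero; suc; _+_; _*_; _∸_; _<_; _>_; _≤_; z≤n; s≤s; z<s)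
open import Data.Nat.Properties
open import Data.Nat.Combinatorics
  using (_C_; nCn≡1; nC1≡n; nCk≡nC[n∸k]; nCk+nC[k+1]≡[n+1]C[k+1])
open import Data.Nat.Tactic.RingSolver using (solve-∀)
open import Data.Product using (_×_; _,_)
open import Data.Sum using (_⊎_; inj₁; inj₂)
open import Relation.Binary.PropositionalEquality
  using (_≡_; refl; sym; trans; cong; cong₂; module ≡-Reasoning)

[1+n]Cn≡1+n : ∀ n → suc n C n ≡ suc n
[1+n]Cn≡1+n n = begin
  suc n C n               ≡⟨ nCk≡nC[n∸k] (n≤1+n n) ⟩
  suc n C (1 + n ∸ n)     ≡⟨ cong (suc n C_) (m+n∸n≡m 1 n) ⟩
  suc n C 1               ≡⟨ nC1≡n (suc n) ⟩
  suc n                   ∎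
  where open ≡-Reasoning

[1+k]*[1+n]C[1+k]≡[1+n]*nCk : ∀ n k → suc k * (suc n C suc k) ≡ suc n * (n C k)
[1+k]*[1+n]C[1+k]≡[1+n]*nCk zero    zero    = refl
[1+k]*[1+n]C[1+k]≡[1+n]*nCk zero    (suc k) = *-zeroʳ (suc (suc k))
[1+k]*[1+n]C[1+k]≡[1+n]*nCk (suc n) zero    = begin
  1 * (suc (suc n) C 1)   ≡⟨ *-identityˡ _ ⟩
  suc (suc n) C 1         ≡⟨ nC1≡n (suc (suc n)) ⟩
  suc (suc n)             ≡⟨ *-identityʳ (suc (suc n)) ⟨
  suc (suc n) * 1         ∎
  where open ≡-Reasoning
[1+k]*[1+n]C[1+k]≡[1+n]*nCk (suc n) (suc k) = begin
  suc (suc k) * (suc (suc n) C suc (suc k))   ≡⟨ cong (suc (suc k) *_) (sym (nCk+nC[k+1]≡[n+1]C[k+1] (suc n) (suc k))) ⟩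
  suc (suc k) * (X + Y)                       ≡⟨ *-distribˡ-+ (suc (suc k)) X Y ⟩
  (X + suc k * X) + suc (suc k) * Y           ≡⟨ cong₂ (λ a b → (X + a) + b) ([1+k]*[1+n]C[1+k]≡[1+n]*nCk n k) ([1+k]*[1+n]C[1+k]≡[1+n]*nCk n (suc k)) ⟩
  (X + suc n * (n C k)) + suc n * (n C suc k) ≡⟨ +-assoc X _ _ ⟩
  X + (suc n * (n C k) + suc n * (n C suc k)) ≡⟨ cong (X +_) (sym (*-distribˡ-+ (suc n) (n C k) (n C suc k))) ⟩
  X + suc n * (n C k + n C suc k)             ≡⟨ cong (λ a → X + suc n * a) (nCk+nC[k+1]≡[n+1]C[k+1] n k) ⟩
  suc (suc n) * X                             ∎
  where
  open ≡-Reasoning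
  X = suc n C suc k
  Y = suc n C suc (suc k)

[1+k][2+k]*[2+n]C[2+k]≡[1+n][2+n]*nCk : ∀ n k →
  (suc k * suc (suc k)) * (suc (suc n) C suc (suc k)) ≡ (suc n * suc (suc n)) * (n C k)
[1+k][2+k]*[2+n]C[2+k]≡[1+n][2+n]*nCk n k = begin
  (suc k * suc (suc k)) * (suc (suc n) C suc (suc k)) ≡⟨ *-assoc (suc k) (suc (suc k)) (suc (suc n) C suc (suc k)) ⟩
  suc k * (suc (suc k) * (suc (suc n) C suc (suc k))) ≡⟨ cong (suc k *_) ([1+k]*[1+n]C[1+k]≡[1+n]*nCk (suc n) (suc k)) ⟩
  suc k * (suc (suc n) * (suc n C suc k))             ≡⟨ x[yz]≡y[xz] (suc k) (suc (suc n)) (suc n C suc k) ⟩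
  suc (suc n) * (suc k * (suc n C suc k))             ≡⟨ cong (suc (suc n) *_) ([1+k]*[1+n]C[1+k]≡[1+n]*nCk n k) ⟩
  suc (suc n) * (suc n * (n C k))                     ≡⟨ x[yz]≡y[xz] (suc (suc n)) (suc n) (n C k) ⟩
  suc n * (suc (suc n) * (n C k))                     ≡⟨ *-assoc (suc n) (suc (suc n)) (n C k) ⟨
  (suc n * suc (suc n)) * (n C k)                     ∎
  where
  open ≡-Reasoning
  x[yz]≡y[xz] : ∀ x y z → x * (y * z) ≡ y * (x * z)
  x[yz]≡y[xz] = solve-∀

2*[1+n]C2≡[1+n]*n : ∀ n → 2 * (suc n C 2) ≡ suc n * n
2*[1+n]C2≡[1+n]*n zero    = refl
2*[1+n]C2≡[1+n]*n (suc n) = begin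
  2 * (suc (suc n) C 2)     ≡⟨ [1+k]*[1+n]C[1+k]≡[1+n]*nCk (suc n) 1 ⟩
  suc (suc n) * (suc n C 1) ≡⟨ cong (suc (suc n) *_) (nC1≡n (suc n)) ⟩
  suc (suc n) * suc n       ∎
  where open ≡-Reasoning

-- The slack polynomial in the variables m ∸ 2 and k ∸ 2 has nonnegative coefficients.
2[1+m+k][2+m+k]≤[1+m]m[1+k][2+k] : ∀ {m k} → 2 ≤ m → 2 ≤ k →
  2 * (suc (m + k) * suc (suc (m + k))) ≤ (suc m * m) * (suc k * suc (suc k))
2[1+m+k][2+m+k]≤[1+m]m[1+k][2+k] {suc (suc x)} {suc (suc y)} (s≤s (s≤s _)) (s≤s (s≤s _)) =
  ≤-trans (m≤m+n _ _) (≤-reflexive (expand x y))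
  where
  expand : ∀ x y →
    2 * (suc (suc (suc x) + suc (suc y)) * suc (suc (suc (suc x) + suc (suc y))))
      + (12 + 20 * y + 4 * y * y + 38 * x + 31 * x * y + 5 * x * y * y
         + 10 * x * x + 7 * x * x * y + x * x * y * y)
      ≡ (suc (suc (suc x)) * suc (suc x)) * (suc (suc (suc y)) * suc (suc (suc (suc y))))
  expand = solve-∀

fW[1]ω≡fpK2[1]ω : ∀ ω → fW 1 ω ≡ fpK2 1 ω
fW[1]ω≡fpK2[1]ω ω = refl

fW[2][1+m]≡fpK2[2][1+m] : ∀ m → fW 2 (suc m) ≡ fpK2 2 (suc m)
fW[2][1+m]≡fpK2[2][1+m] m = begin
  (suc m C 2) * 1 + suc m       ≡⟨ cong₂ _+_ (*-identityʳ (suc m C 2)) (sym (nC1≡n (suc m))) ⟩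
  suc m C 2 + suc m C 1         ≡⟨ +-comm (suc m C 2) (suc m C 1) ⟩
  suc m C 1 + suc m C 2         ≡⟨ nCk+nC[k+1]≡[n+1]C[k+1] (suc m) 1 ⟩
  suc (suc m) C 2               ≡⟨ cong (_C 2) (+-comm 2 m) ⟩
  (m + 2) C 2                   ∎
  where open ≡-Reasoning

fW[1+p]1≡fpK2[1+p]1 : ∀ p → fW (suc p) 1 ≡ fpK2 (suc p) 1
fW[1+p]1≡fpK2[1+p]1 zero    = refl
fW[1+p]1≡fpK2[1+p]1 (suc p) = sym (nCn≡1 (2 * suc p))

fW[1+p]2≡1+2p : ∀ p → fW (suc p) 2 ≡ suc (2 * p)
fW[1+p]2≡1+2p zero    = refl
fW[1+p]2≡1+2p (suc p) = trans (cong (λ x → 1 * x + 2) (fW[1+p]2≡1+2p p)) (1*[1+2p]+2≡1+2[1+p] p)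
  where
  1*[1+2p]+2≡1+2[1+p] : ∀ p → 1 * suc (2 * p) + 2 ≡ suc (2 * suc p)
  1*[1+2p]+2≡1+2[1+p] = solve-∀

fW[1+p]2≡fpK2[1+p]2 : ∀ p → fW (suc p) 2 ≡ fpK2 (suc p) 2
fW[1+p]2≡fpK2[1+p]2 p = trans (fW[1+p]2≡1+2p p) (sym ([1+n]Cn≡1+n (2 * p)))

fpK2[2+p][1+m]≡[2+m+2p]C[2+2p] : ∀ m p →
  fpK2 (suc (suc p)) (suc m) ≡ suc (suc (m + 2 * p)) C suc (suc (2 * p))
fpK2[2+p][1+m]≡[2+m+2p]C[2+2p] m p = cong₂ _C_ (m+2[1+p]≡2+[m+2p] m p) (*-suc 2 p)
  where
  m+2[1+p]≡2+[m+2p] : ∀ m p → m + 2 * suc p ≡ suc (suc (m + 2 * p))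
  m+2[1+p]≡2+[m+2p] = solve-∀

fpK2[2+p]≤[1+m]C2*fpK2[1+p] : ∀ {m p} → 2 ≤ m → 1 ≤ p →
  fpK2 (suc (suc p)) (suc m) ≤ (suc m C 2) * fpK2 (suc p) (suc m)
fpK2[2+p]≤[1+m]C2*fpK2[1+p] {m} {p} 2≤m 1≤p = *-cancelˡ-≤ (2 * K) (begin
  (2 * K) * fpK2 (suc (suc p)) (suc m)  ≡⟨ cong ((2 * K) *_) (fpK2[2+p][1+m]≡[2+m+2p]C[2+2p] m p) ⟩
  (2 * K) * (suc (suc n) C suc (suc k)) ≡⟨ *-assoc 2 K (suc (suc n) C suc (suc k)) ⟩
  2 * (K * (suc (suc n) C suc (suc k))) ≡⟨ cong (2 *_) ([1+k][2+k]*[2+n]C[2+k]≡[1+n][2+n]*nCk n k) ⟩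
  2 * (N * (n C k))                     ≡⟨ *-assoc 2 N (n C k) ⟨
  (2 * N) * (n C k)                     ≤⟨ *-monoˡ-≤ (n C k) (2[1+m+k][2+m+k]≤[1+m]m[1+k][2+k] 2≤m (*-monoʳ-≤ 2 1≤p)) ⟩
  (suc m * m * K) * (n C k)             ≡⟨ cong (λ a → (a * K) * (n C k)) (2*[1+n]C2≡[1+n]*n m) ⟨
  (2 * c * K) * (n C k)                 ≡⟨ [2cK]F≡[2K][cF] c K (n C k) ⟩
  (2 * K) * (c * (n C k))               ∎)
  where
  open ≤-Reasoning
  k = 2 * p
  n = m + k
  K = suc k * suc (suc k)
  N = suc n * suc (suc n)
  c = suc m C 2
  [2cK]F≡[2K][cF] : ∀ c K F → (2 * c * K) * F ≡ (2 * K) * (c * F)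
  [2cK]F≡[2K][cF] = solve-∀

fpK2[2+p]<fW[2+p] : ∀ {m p} → 2 ≤ m → 1 ≤ p → fpK2 (suc p) (suc m) ≤ fW (suc p) (suc m) →
  fpK2 (suc (suc p)) (suc m) < fW (suc (suc p)) (suc m)
fpK2[2+p]<fW[2+p] {m} {p} 2≤m 1≤p fpK2≤fW = begin-strict
  fpK2 (suc (suc p)) (suc m)           ≤⟨ fpK2[2+p]≤[1+m]C2*fpK2[1+p] 2≤m 1≤p ⟩
  (suc m C 2) * fpK2 (suc p) (suc m)   ≤⟨ *-monoʳ-≤ (suc m C 2) fpK2≤fW ⟩
  (suc m C 2) * fW (suc p) (suc m)     <⟨ m<m+n _ z<s ⟩
  fW (suc (suc p)) (suc m)             ∎
  where open ≤-Reasoning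

fpK2≤fW : ∀ {m} p → 2 ≤ m → fpK2 (suc p) (suc m) ≤ fW (suc p) (suc m)
fpK2≤fW {m} zero          _   = ≤-reflexive (sym (fW[1]ω≡fpK2[1]ω (suc m)))
fpK2≤fW {m} (suc zero)    _   = ≤-reflexive (sym (fW[2][1+m]≡fpK2[2][1+m] m))
fpK2≤fW     (suc (suc p)) 2≤m = <⇒≤ (fpK2[2+p]<fW[2+p] 2≤m (s≤s z≤n) (fpK2≤fW (suc p) 2≤m))

mainTheorem18 : (ω p : ℕ) → 1 ≤ ω → 1 ≤ p →
    ((ω > 2 × p > 2) → fW p ω > fpK2 p ω) ×
    ((ω ≤ 2 ⊎ p ≤ 2) → fW p ω ≡ fpK2 p ω)
mainTheorem18 ω p 1≤ω 1≤p = strict ω p , equal ω p 1≤ω 1≤p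
  where
  strict : ∀ ω p → ω > 2 × p > 2 → fW p ω > fpK2 p ω
  strict (suc m) (suc (suc p)) (s≤s 2≤m , s≤s (s≤s 1≤p)) =
    fpK2[2+p]<fW[2+p] 2≤m 1≤p (fpK2≤fW p 2≤m)
  equal : ∀ ω p → 1 ≤ ω → 1 ≤ p → ω ≤ 2 ⊎ p ≤ 2 → fW p ω ≡ fpK2 p ω
  equal ω       (suc zero)       _ _ _ = fW[1]ω≡fpK2[1]ω ω
  equal (suc m) (suc (suc zero)) _ _ _ = fW[2][1+m]≡fpK2[2][1+m] m
  equal (suc zero)       (suc p) _ _ _ = fW[1+p]1≡fpK2[1+p]1 p
  equal (suc (suc zero)) (suc p) _ _ _ = fW[1+p]2≡fpK2[1+p]2 p
  equal (suc (suc (suc _))) (suc (suc (suc _))) _ _ (inj₁ (s≤s (s≤s ())))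
  equal (suc (suc (suc _))) (suc (suc (suc _))) _ _ (inj₂ (s≤s (s≤s ())))
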